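{- Let $q$ be an indeterminate, $s$ a parameter, and define the discrete $q$-Hermite-type polynomials $$H_n(x,s,q)=\sum_{k=0}^{\lfloor n/2\rfloor}(-s)^kq^{k^2}\frac{[n]_q!}{[k]_q!\,[n-2k]_q!}\,\frac{1}{(-q;q)_k}\,x^{n-2k}.$$ Then for every $n\ge0$, $$H_{2n+1}(x,s,q)=\sum_{k=0}^n(-1)^k\begin{bmatrix}2n+1\\2k+1\end{bmatrix}T_{2k+1}(q)\,x^{2k+1}H_{2n-2k}(x,s,q),$$ where the $q$-tangent numbers $T_{2k+1}(q)$ are defined by $$\sum_{n\ge0}(-1)^n\frac{T_{2n+1}(q)}{[2n+1]_q!}z^{2n+1}=\frac{e_q(z)-e_q(-z)}{e_q(z)+e_q(-z)},\qquad e_q(z)=\sum_{n\ge0}\frac{z^n}{[n]_q!}.$$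
   Context: $[n]_q=\frac{1-q^n}{1-q}$, $[n]_q!=[1]_q\cdots[n]_q$, $[0]_q!=1$; $\begin{bmatrix}n\\k\end{bmatrix}=\frac{[n]_q!}{[k]_q![n-k]_q!}$; $(a;q)_n=(1-a)(1-qa)\cdots(1-q^{n-1}a)$, $(a;q)_0=1$. -}

module Defs where

open import Level using (Level)
open import Algebra.Bundles using (CommutativeRing)
open import Data.Nat using (ℕ; zero; suc; _∸_; ⌊_/2⌋)
import Data.Nat as N

-- All definitions are relative to a commutative ring R, an element q of R,
-- and chosen inverses  invQ n = ([n+1]_q)⁻¹  and  invP i = (1 + q^(i+1))⁻¹
-- (the hypotheses that these really are inverses live in the statement).
module QDefs {c ℓ : Level} (R : CommutativeRing c ℓ) (q : CommutativeRing.Carrier R)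
             (invQ : ℕ → CommutativeRing.Carrier R)
             (invP : ℕ → CommutativeRing.Carrier R) where

  open CommutativeRing R

  pow : Carrier → ℕ → Carrier
  pow a zero    = 1#
  pow a (suc n) = a * pow a n

  sumTo : ℕ → (ℕ → Carrier) → Carrier
  sumTo zero    f = f 0
  sumTo (suc m) f = sumTo m f + f (suc m)

  sumBelow : ℕ → (ℕ → Carrier) → Carrier
  sumBelow zero    f = 0#
  sumBelow (suc m) f = sumBelow m f + f m

  prodBelow : ℕ → (ℕ → Carrier) → Carrier
  prodBelow zero    f = 1#
  prodBelow (suc m) f = prodBelow m f * f m

  qint : ℕ → Carrier
  qint n = sumBelow n (pow q)

  qfact : ℕ → Carrier
  qfact n = prodBelow n (λ i → qint (suc i))

  qfactInv : ℕ → Carrier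
  qfactInv n = prodBelow n invQ

  -- q-binomial coefficient [n choose k]_q (used with k ≤ n)
  qbinom : ℕ → ℕ → Carrier
  qbinom n k = qfact n * qfactInv k * qfactInv (n ∸ k)

  pochNegQ : ℕ → Carrier
  pochNegQ k = prodBelow k (λ i → 1# + pow q (suc i))

  pochNegQInv : ℕ → Carrier
  pochNegQInv k = prodBelow k invP

  H : Carrier → Carrier → ℕ → Carrier
  H x s n = sumTo ⌊ n /2⌋ (λ k →
      pow (- s) k * pow q (k N.* k) * qfact n * qfactInv k
        * qfactInv (n ∸ 2 N.* k) * pochNegQInv k * pow x (n ∸ 2 N.* k))

  FPS : Set c
  FPS = ℕ → Carrier

  conv : FPS → FPS → FPS
  conv a b m = sumTo m (λ i → a i * b (m ∸ i))

  eqSeries : FPS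
  eqSeries m = qfactInv m

  eqNegSeries : FPS
  eqNegSeries m = pow (- 1#) m * qfactInv m

  -- Σ_n (-1)^n T_{2n+1}/[2n+1]_q! z^{2n+1},  with  T j  standing for  T_{2j+1}(q)
  -- keep the value a when m is odd, 0 when m is even
  onlyOdd : ℕ → Carrier → Carrier
  onlyOdd zero          a = 0#
  onlyOdd (suc zero)    a = a
  onlyOdd (suc (suc m)) a = onlyOdd m a

  tanSeries : (ℕ → Carrier) → FPS
  tanSeries T m = onlyOdd m (pow (- 1#) ⌊ m /2⌋ * T ⌊ m /2⌋ * qfactInv m)

  coshLike : FPS
  coshLike m = eqSeries m + eqNegSeries m

  sinhLike : FPS
  sinhLike m = eqSeries m - eqNegSeries m

-- Put F(z) = Σₖ aₖ z^{2k} with aₖ = (-s)^k q^{k²} / ([k]_q! (-q;q)ₖ) and G(z) = e_q(xz) F(z);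
-- then H_m(x,s,q) = [m]_q! · [z^m] G(z).  As F is even, G(z) ± G(-z) = (e_q(xz) ± e_q(-xz)) F(z),
-- so the defining identity of the q-tangent numbers, taken at xz, says
-- tan_q(xz) · (G(z) + G(-z)) = G(z) - G(-z).  Only odd powers occur in tan_q and only even
-- ones in G(z) + G(-z), so the coefficient of z^{2n+1} reads
-- 2 g_{2n+1} = 2 Σₖ (-1)^k T_{2k+1} x^{2k+1} / [2k+1]_q! · g_{2n-2k};
-- halving it and multiplying by [2n+1]_q! gives the recurrence.
module Submission where

open import Defs
open import Level using (Level)
open import Algebra.Bundles using (CommutativeRing)
open import Data.Nat using (ℕ; zero; suc; _≤_; z≤n; _∸_; ⌊_/2⌋)
import Data.Nat as N
open import Data.Nat.Properties
  using (m≤n⇒m≤1+n; ≤-refl; +-suc; +-∸-assoc; ∸-+-assoc; n∸n≡0; m∸[m∸n]≡n; m+[n∸m]≡n)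
  renaming (+-comm to ℕ-+-comm)
open import Function using (_∘_)
open import Relation.Binary.PropositionalEquality as P using (_≡_)
import Algebra.Solver.CommutativeMonoid

double : ℕ → ℕ
double zero    = zero
double (suc n) = suc (suc (double n))

2*n≡double : ∀ n → 2 N.* n ≡ double n
2*n≡double zero    = P.refl
2*n≡double (suc n) = P.cong suc (P.trans (+-suc n (n N.+ 0)) (P.cong suc (2*n≡double n)))

2*n+1≡suc-double : ∀ n → 2 N.* n N.+ 1 ≡ suc (double n)
2*n+1≡suc-double n = P.trans (ℕ-+-comm (2 N.* n) 1) (P.cong suc (2*n≡double n))

double-∸ : ∀ m n → double m ∸ double n ≡ double (m ∸ n)
double-∸ zero    zero    = P.refl
double-∸ zero    (suc n) = P.refl
double-∸ (suc m) zero    = P.refl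
double-∸ (suc m) (suc n) = double-∸ m n

⌊double/2⌋≡ : ∀ n → ⌊ double n /2⌋ ≡ n
⌊double/2⌋≡ zero    = P.refl
⌊double/2⌋≡ (suc n) = P.cong suc (⌊double/2⌋≡ n)

⌊suc-double/2⌋≡ : ∀ n → ⌊ suc (double n) /2⌋ ≡ n
⌊suc-double/2⌋≡ zero    = P.refl
⌊suc-double/2⌋≡ (suc n) = P.cong suc (⌊suc-double/2⌋≡ n)

∸-∸-cancel : ∀ m {i k} → i ≤ k → m ∸ i ∸ (k ∸ i) ≡ m ∸ k
∸-∸-cancel m {i} {k} i≤k = P.trans (∸-+-assoc m i (k ∸ i)) (P.cong (m ∸_) (m+[n∸m]≡n i≤k))

module QHermite {c ℓ : Level} (R : CommutativeRing c ℓ) (q : CommutativeRing.Carrier R)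
         (invQ invP : ℕ → CommutativeRing.Carrier R) where

  open CommutativeRing R
  open QDefs R q invQ invP
  open import Relation.Binary.Reasoning.Setoid setoid
  open import Algebra.Properties.Ring ring using (-1*x≈-x; -‿involutive; -‿distribʳ-*)
  open import Algebra.Properties.CommutativeSemigroup *-commutativeSemigroup
    using (x∙yz≈y∙xz) renaming (interchange to *-interchange)
  open import Algebra.Properties.CommutativeSemigroup +-commutativeSemigroup
    using () renaming (interchange to +-interchange)
  module *-Solver = Algebra.Solver.CommutativeMonoid *-commutativeMonoid
  open *-Solver using (_⊜_) renaming (_⊕_ to _⊗_)

  sumTo-cong : ∀ m {f g : ℕ → Carrier} → (∀ i → i ≤ m → f i ≈ g i) → sumTo m f ≈ sumTo m g
  sumTo-cong zero    f≈g = f≈g 0 z≤n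
  sumTo-cong (suc m) f≈g =
    +-cong (sumTo-cong m (λ i i≤m → f≈g i (m≤n⇒m≤1+n i≤m))) (f≈g (suc m) ≤-refl)

  sumTo-cong′ : ∀ m {f g : ℕ → Carrier} → (∀ i → f i ≈ g i) → sumTo m f ≈ sumTo m g
  sumTo-cong′ m f≈g = sumTo-cong m (λ i _ → f≈g i)

  sumTo-+ : ∀ m (f g : ℕ → Carrier) → sumTo m (λ i → f i + g i) ≈ sumTo m f + sumTo m g
  sumTo-+ zero    f g = refl
  sumTo-+ (suc m) f g = trans (+-cong (sumTo-+ m f g) refl)
    (+-interchange _ _ _ _)

  *-distribˡ-sumTo : ∀ m a (f : ℕ → Carrier) → a * sumTo m f ≈ sumTo m (λ i → a * f i)
  *-distribˡ-sumTo zero    a f = refl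
  *-distribˡ-sumTo (suc m) a f = trans (distribˡ a _ _) (+-cong (*-distribˡ-sumTo m a f) refl)

  *-distribʳ-sumTo : ∀ m a (f : ℕ → Carrier) → sumTo m f * a ≈ sumTo m (λ i → f i * a)
  *-distribʳ-sumTo zero    a f = refl
  *-distribʳ-sumTo (suc m) a f = trans (distribʳ a _ _) (+-cong (*-distribʳ-sumTo m a f) refl)

  sumTo-suc : ∀ m (f : ℕ → Carrier) → sumTo (suc m) f ≈ f 0 + sumTo m (f ∘ suc)
  sumTo-suc zero    f = refl
  sumTo-suc (suc m) f = trans (+-cong (sumTo-suc m f) refl) (+-assoc _ _ _)

  sumTo-reverse : ∀ m (f : ℕ → Carrier) → sumTo m f ≈ sumTo m (λ i → f (m ∸ i))
  sumTo-reverse zero    f = refl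
  sumTo-reverse (suc m) f = begin
    sumTo m f + f (suc m)                  ≈⟨ +-cong (sumTo-reverse m f) refl ⟩
    sumTo m (λ i → f (m ∸ i)) + f (suc m)  ≈⟨ +-comm _ _ ⟩
    f (suc m) + sumTo m (λ i → f (m ∸ i))  ≈⟨ sumTo-suc m (λ i → f (suc m ∸ i)) ⟨
    sumTo (suc m) (λ i → f (suc m ∸ i))    ∎

  sumTo-triangle : ∀ (F : ℕ → ℕ → Carrier) m →
                   sumTo m (λ i → sumTo (m ∸ i) (F i)) ≈ sumTo m (λ k → sumTo k (λ i → F i (k ∸ i)))
  sumTo-triangle F zero    = refl
  sumTo-triangle F (suc m) = begin
    sumTo m (λ i → sumTo (suc m ∸ i) (F i)) + sumTo (suc m ∸ suc m) (F (suc m))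
      ≈⟨ +-cong (sumTo-cong m (λ i i≤m → reflexive (P.cong (λ j → sumTo j (F i)) (+-∸-assoc 1 i≤m))))
                (reflexive (P.cong (λ j → sumTo j (F (suc m))) (n∸n≡0 m))) ⟩
    sumTo m (λ i → sumTo (m ∸ i) (F i) + F i (suc (m ∸ i))) + F (suc m) 0
      ≈⟨ trans (+-cong (sumTo-+ m _ _) refl) (+-assoc _ _ _) ⟩
    sumTo m (λ i → sumTo (m ∸ i) (F i)) + (sumTo m (λ i → F i (suc (m ∸ i))) + F (suc m) 0)
      ≈⟨ +-cong (sumTo-triangle F m)
                (+-cong (sumTo-cong m (λ i i≤m → reflexive (P.cong (F i) (P.sym (+-∸-assoc 1 i≤m)))))
                        (reflexive (P.cong (F (suc m)) (P.sym (n∸n≡0 m))))) ⟩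
    sumTo m (λ k → sumTo k (λ i → F i (k ∸ i))) + sumTo (suc m) (λ i → F i (suc m ∸ i))
      ∎

  sumTo-evenSupported : ∀ m (f : ℕ → Carrier) → (∀ k → f (suc (double k)) ≈ 0#) →
                        sumTo m f ≈ sumTo ⌊ m /2⌋ (f ∘ double)
  sumTo-evenSupported zero          f f-odd = refl
  sumTo-evenSupported (suc zero)    f f-odd = trans (+-cong refl (f-odd 0)) (+-identityʳ _)
  sumTo-evenSupported (suc (suc m)) f f-odd = begin
    sumTo (suc (suc m)) f
      ≈⟨ trans (sumTo-suc (suc m) f) (+-cong refl (sumTo-suc m (f ∘ suc))) ⟩
    f 0 + (f 1 + sumTo m (f ∘ suc ∘ suc))
      ≈⟨ +-cong refl (trans (+-cong (f-odd 0) refl) (+-identityˡ _)) ⟩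
    f 0 + sumTo m (f ∘ suc ∘ suc)
      ≈⟨ +-cong refl (sumTo-evenSupported m (f ∘ suc ∘ suc) (f-odd ∘ suc)) ⟩
    f 0 + sumTo ⌊ m /2⌋ (f ∘ double ∘ suc)
      ≈⟨ sumTo-suc ⌊ m /2⌋ (f ∘ double) ⟨
    sumTo (suc ⌊ m /2⌋) (f ∘ double)
      ∎

  sumTo-oddSupported : ∀ n (f : ℕ → Carrier) → (∀ k → f (double k) ≈ 0#) →
                       sumTo (suc (double n)) f ≈ sumTo n (f ∘ suc ∘ double)
  sumTo-oddSupported n f f-even = begin
    sumTo (suc (double n)) f
      ≈⟨ sumTo-suc (double n) f ⟩
    f 0 + sumTo (double n) (f ∘ suc)
      ≈⟨ +-cong (f-even 0) (sumTo-evenSupported (double n) (f ∘ suc) (f-even ∘ suc)) ⟩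
    0# + sumTo ⌊ double n /2⌋ (f ∘ suc ∘ double)
      ≈⟨ +-identityˡ _ ⟩
    sumTo ⌊ double n /2⌋ (f ∘ suc ∘ double)
      ≡⟨ P.cong (λ j → sumTo j (f ∘ suc ∘ double)) (⌊double/2⌋≡ n) ⟩
    sumTo n (f ∘ suc ∘ double)
      ∎

  pow-+ : ∀ a i j → pow a (i N.+ j) ≈ pow a i * pow a j
  pow-+ a zero    j = sym (*-identityˡ _)
  pow-+ a (suc i) j = trans (*-cong refl (pow-+ a i j)) (sym (*-assoc _ _ _))

  pow-∸ : ∀ a {i m} → i ≤ m → pow a i * pow a (m ∸ i) ≈ pow a m
  pow-∸ a {i} {m} i≤m = trans (sym (pow-+ a i (m ∸ i))) (reflexive (P.cong (pow a) (m+[n∸m]≡n i≤m)))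

  -1*-1≈1 : - 1# * - 1# ≈ 1#
  -1*-1≈1 = trans (-1*x≈-x (- 1#)) (-‿involutive 1#)

  pow-[-1]-double : ∀ k → pow (- 1#) (double k) ≈ 1#
  pow-[-1]-double zero    = refl
  pow-[-1]-double (suc k) = trans (sym (*-assoc _ _ _)) (trans (*-cong -1*-1≈1 (pow-[-1]-double k)) (*-identityˡ _))

  pow-[-1]-suc-double : ∀ k → pow (- 1#) (suc (double k)) ≈ - 1#
  pow-[-1]-suc-double k = trans (*-cong refl (pow-[-1]-double k)) (*-identityʳ _)

  x+x-injective : ∀ (half : Carrier) → half * (1# + 1#) ≈ 1# → ∀ {a b} → a + a ≈ b + b → a ≈ b
  x+x-injective half half-inv {a} {b} a+a≈b+b = begin
    a                 ≈⟨ halve a ⟩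
    half * (a + a)    ≈⟨ *-cong refl a+a≈b+b ⟩
    half * (b + b)    ≈⟨ halve b ⟨
    b                 ∎
    where
    halve : ∀ d → d ≈ half * (d + d)
    halve d = begin
      d                     ≈⟨ *-identityˡ d ⟨
      1# * d                ≈⟨ *-cong half-inv refl ⟨
      half * (1# + 1#) * d  ≈⟨ *-assoc _ _ _ ⟩
      half * ((1# + 1#) * d) ≈⟨ *-cong refl (trans (distribʳ _ _ _) (+-cong (*-identityˡ d) (*-identityˡ d))) ⟩
      half * (d + d)        ∎

  -- dilate c a is the series a(cz); dilate (- 1#) a is a(-z).
  dilate : Carrier → FPS → FPS
  dilate c a i = pow c i * a i

  conv-congˡ : ∀ {a a′ : FPS} → (∀ i → a i ≈ a′ i) → ∀ b m → conv a b m ≈ conv a′ b m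
  conv-congˡ a≈a′ b m = sumTo-cong′ m (λ i → *-cong (a≈a′ i) refl)

  conv-congʳ : ∀ a {b b′ : FPS} → (∀ i → b i ≈ b′ i) → ∀ m → conv a b m ≈ conv a b′ m
  conv-congʳ a b≈b′ m = sumTo-cong′ m (λ i → *-cong refl (b≈b′ (m ∸ i)))

  conv-comm : ∀ (a b : FPS) m → conv a b m ≈ conv b a m
  conv-comm a b m = trans (sumTo-reverse m _)
    (sumTo-cong m (λ i i≤m → trans (*-comm _ _) (*-cong (reflexive (P.cong b (m∸[m∸n]≡n i≤m))) refl)))

  conv-assoc : ∀ (a b d : FPS) m → conv a (conv b d) m ≈ conv (conv a b) d m
  conv-assoc a b d m = begin
    sumTo m (λ i → a i * sumTo (m ∸ i) (λ j → b j * d (m ∸ i ∸ j)))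
      ≈⟨ sumTo-cong′ m (λ i → *-distribˡ-sumTo (m ∸ i) (a i) _) ⟩
    sumTo m (λ i → sumTo (m ∸ i) (λ j → a i * (b j * d (m ∸ i ∸ j))))
      ≈⟨ sumTo-triangle (λ i j → a i * (b j * d (m ∸ i ∸ j))) m ⟩
    sumTo m (λ k → sumTo k (λ i → a i * (b (k ∸ i) * d (m ∸ i ∸ (k ∸ i)))))
      ≈⟨ sumTo-cong′ m (λ k → sumTo-cong k (λ i i≤k →
           trans (sym (*-assoc _ _ _)) (*-cong refl (reflexive (P.cong d (∸-∸-cancel m i≤k)))))) ⟩
    sumTo m (λ k → sumTo k (λ i → a i * b (k ∸ i) * d (m ∸ k)))
      ≈⟨ sumTo-cong′ m (λ k → sym (*-distribʳ-sumTo k (d (m ∸ k)) _)) ⟩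
    sumTo m (λ k → conv a b k * d (m ∸ k))
      ∎

  conv-distribʳ-+ : ∀ (a b d : FPS) m → conv (λ i → a i + b i) d m ≈ conv a d m + conv b d m
  conv-distribʳ-+ a b d m = trans (sumTo-cong′ m (λ i → distribʳ _ _ _)) (sumTo-+ m _ _)

  conv-distribʳ-minus : ∀ (a b d : FPS) m → conv (λ i → a i - b i) d m ≈ conv a d m - conv b d m
  conv-distribʳ-minus a b d m = begin
    conv (λ i → a i - b i) d m
      ≈⟨ conv-congˡ (λ i → +-cong refl (sym (-1*x≈-x (b i)))) d m ⟩
    conv (λ i → a i + - 1# * b i) d m
      ≈⟨ conv-distribʳ-+ a _ d m ⟩
    conv a d m + sumTo m (λ i → - 1# * b i * d (m ∸ i))
      ≈⟨ +-cong refl (trans (sumTo-cong′ m (λ i → *-assoc _ _ _)) (sym (*-distribˡ-sumTo m (- 1#) _))) ⟩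
    conv a d m + - 1# * conv b d m
      ≈⟨ +-cong refl (-1*x≈-x _) ⟩
    conv a d m - conv b d m
      ∎

  conv-dilate : ∀ c (a b : FPS) m → conv (dilate c a) (dilate c b) m ≈ dilate c (conv a b) m
  conv-dilate c a b m = begin
    sumTo m (λ i → pow c i * a i * (pow c (m ∸ i) * b (m ∸ i)))
      ≈⟨ sumTo-cong m (λ i i≤m → trans
           (*-interchange _ _ _ _)
           (*-cong (pow-∸ c i≤m) refl)) ⟩
    sumTo m (λ i → pow c m * (a i * b (m ∸ i)))
      ≈⟨ *-distribˡ-sumTo m (pow c m) _ ⟨
    pow c m * conv a b m
      ∎

  conv-reflect : ∀ (a f : FPS) → (∀ i → dilate (- 1#) f i ≈ f i) →
                 ∀ m → conv (dilate (- 1#) a) f m ≈ dilate (- 1#) (conv a f) m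
  conv-reflect a f f-even m = trans (conv-congʳ (dilate (- 1#) a) (sym ∘ f-even) m) (conv-dilate (- 1#) a f m)

  oddCoefficient-recurrence :
    ∀ (half : Carrier) → half * (1# + 1#) ≈ 1# →
    ∀ (t G : FPS) → (∀ k → t (double k) ≈ 0#) →
    (∀ m → conv t (λ i → G i + dilate (- 1#) G i) m ≈ G m - dilate (- 1#) G m) →
    ∀ n → G (suc (double n)) ≈ sumTo n (λ k → t (suc (double k)) * G (double (n ∸ k)))
  oddCoefficient-recurrence half half-inv t G t-odd tG n = x+x-injective half half-inv (begin
    G N + G N
      ≈⟨ oddPart ⟨
    G N - dilate (- 1#) G N
      ≈⟨ tG N ⟨
    sumTo N (λ i → t i * (G (N ∸ i) + dilate (- 1#) G (N ∸ i)))
      ≈⟨ sumTo-oddSupported n _ (λ k → trans (*-cong (t-odd k) refl) (zeroˡ _)) ⟩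
    sumTo n (λ k → t (suc (double k)) * (G (double n ∸ double k) + dilate (- 1#) G (double n ∸ double k)))
      ≈⟨ sumTo-cong′ n (λ k → *-cong refl
           (trans (reflexive (P.cong (λ j → G j + dilate (- 1#) G j) (double-∸ n k))) (evenPart (n ∸ k)))) ⟩
    sumTo n (λ k → t (suc (double k)) * (G (double (n ∸ k)) + G (double (n ∸ k))))
      ≈⟨ trans (sumTo-cong′ n (λ k → distribˡ _ _ _)) (sumTo-+ n _ _) ⟩
    S + S
      ∎)
    where
    N : ℕ
    N = suc (double n)
    S : Carrier
    S = sumTo n (λ k → t (suc (double k)) * G (double (n ∸ k)))

    evenPart : ∀ j → G (double j) + dilate (- 1#) G (double j) ≈ G (double j) + G (double j)
    evenPart j = +-cong refl (trans (*-cong (pow-[-1]-double j) refl) (*-identityˡ _))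

    oddPart : G N - dilate (- 1#) G N ≈ G N + G N
    oddPart = +-cong refl (begin
      - (pow (- 1#) N * G N)  ≈⟨ -‿cong (*-cong (pow-[-1]-suc-double n) refl) ⟩
      - (- 1# * G N)          ≈⟨ -‿cong (-1*x≈-x (G N)) ⟩
      - - G N                 ≈⟨ -‿involutive (G N) ⟩
      G N                     ∎)

  spreadEven : (ℕ → Carrier) → FPS
  spreadEven a zero          = a 0
  spreadEven a (suc zero)    = 0#
  spreadEven a (suc (suc m)) = spreadEven (a ∘ suc) m

  spreadEven-double : ∀ a k → spreadEven a (double k) ≡ a k
  spreadEven-double a zero    = P.refl
  spreadEven-double a (suc k) = spreadEven-double (a ∘ suc) k

  spreadEven-suc-double : ∀ a k → spreadEven a (suc (double k)) ≡ 0#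
  spreadEven-suc-double a zero    = P.refl
  spreadEven-suc-double a (suc k) = spreadEven-suc-double (a ∘ suc) k

  spreadEven-reflect : ∀ a i → dilate (- 1#) (spreadEven a) i ≈ spreadEven a i
  spreadEven-reflect a zero          = *-identityˡ _
  spreadEven-reflect a (suc zero)    = zeroʳ _
  spreadEven-reflect a (suc (suc i)) = begin
    - 1# * (- 1# * pow (- 1#) i) * spreadEven (a ∘ suc) i  ≈⟨ *-cong (sym (*-assoc _ _ _)) refl ⟩
    - 1# * - 1# * pow (- 1#) i * spreadEven (a ∘ suc) i    ≈⟨ *-cong (trans (*-cong -1*-1≈1 refl) (*-identityˡ _)) refl ⟩
    pow (- 1#) i * spreadEven (a ∘ suc) i                  ≈⟨ spreadEven-reflect (a ∘ suc) i ⟩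
    spreadEven (a ∘ suc) i                                 ∎

  qfactInv-inverse : (∀ n → invQ n * qint (suc n) ≈ 1#) → ∀ m → qfactInv m * qfact m ≈ 1#
  qfactInv-inverse invQ-inv zero    = *-identityˡ _
  qfactInv-inverse invQ-inv (suc m) = begin
    qfactInv m * invQ m * (qfact m * qint (suc m))
      ≈⟨ *-interchange _ _ _ _ ⟩
    qfactInv m * qfact m * (invQ m * qint (suc m))
      ≈⟨ *-cong (qfactInv-inverse invQ-inv m) (invQ-inv m) ⟩
    1# * 1#
      ≈⟨ *-identityˡ _ ⟩
    1#
      ∎

  hermiteWeight : Carrier → ℕ → Carrier
  hermiteWeight s k = pow (- s) k * pow q (k N.* k) * qfactInv k * pochNegQInv k

  hermiteSeries : Carrier → Carrier → FPS
  hermiteSeries x s = conv (dilate x eqSeries) (spreadEven (hermiteWeight s))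

  H≈qfact*hermiteSeries : ∀ x s m → H x s m ≈ qfact m * hermiteSeries x s m
  H≈qfact*hermiteSeries x s m = begin
    H x s m
      ≈⟨ sumTo-cong′ ⌊ m /2⌋ rearrange ⟩
    sumTo ⌊ m /2⌋ (λ k → qfact m * (spreadEven a (double k) * E (m ∸ double k)))
      ≈⟨ *-distribˡ-sumTo ⌊ m /2⌋ (qfact m) _ ⟨
    qfact m * sumTo ⌊ m /2⌋ (λ k → spreadEven a (double k) * E (m ∸ double k))
      ≈⟨ *-cong refl (sumTo-evenSupported m (λ i → spreadEven a i * E (m ∸ i)) odd-vanish) ⟨
    qfact m * conv (spreadEven a) E m
      ≈⟨ *-cong refl (conv-comm (spreadEven a) E m) ⟩
    qfact m * hermiteSeries x s m
      ∎
    where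
    a : ℕ → Carrier
    a = hermiteWeight s
    E : FPS
    E = dilate x eqSeries

    odd-vanish : ∀ k → spreadEven a (suc (double k)) * E (m ∸ suc (double k)) ≈ 0#
    odd-vanish k = trans (*-cong (reflexive (spreadEven-suc-double a k)) refl) (zeroˡ _)

    rearrange : ∀ k →
      pow (- s) k * pow q (k N.* k) * qfact m * qfactInv k
        * qfactInv (m ∸ 2 N.* k) * pochNegQInv k * pow x (m ∸ 2 N.* k)
      ≈ qfact m * (spreadEven a (double k) * E (m ∸ double k))
    rearrange k rewrite 2*n≡double k | spreadEven-double a k =
      *-Solver.solve 7 (λ S Q F I J P X →
          ((((((S ⊗ Q) ⊗ F) ⊗ I) ⊗ J) ⊗ P) ⊗ X) ⊜ (F ⊗ ((((S ⊗ Q) ⊗ I) ⊗ P) ⊗ (X ⊗ J)))) refl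
        (pow (- s) k) (pow q (k N.* k)) (qfact m) (qfactInv k) (qfactInv (m ∸ double k))
        (pochNegQInv k) (pow x (m ∸ double k))

  onlyOdd-double : ∀ k a → onlyOdd (double k) a ≡ 0#
  onlyOdd-double zero    a = P.refl
  onlyOdd-double (suc k) a = onlyOdd-double k a

  onlyOdd-suc-double : ∀ k a → onlyOdd (suc (double k)) a ≡ a
  onlyOdd-suc-double zero    a = P.refl
  onlyOdd-suc-double (suc k) a = onlyOdd-suc-double k a

  tanSeries-double : ∀ T k → tanSeries T (double k) ≡ 0#
  tanSeries-double T k = onlyOdd-double k _

  tanSeries-suc-double : ∀ T k → tanSeries T (suc (double k)) ≡ pow (- 1#) k * T k * qfactInv (suc (double k))
  tanSeries-suc-double T k = P.trans (onlyOdd-suc-double k _)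
    (P.cong (λ j → pow (- 1#) j * T j * qfactInv (suc (double k))) (⌊suc-double/2⌋≡ k))

  dilate-coshLike : ∀ x i → dilate x coshLike i ≈ dilate x eqSeries i + dilate (- 1#) (dilate x eqSeries) i
  dilate-coshLike x i = trans (distribˡ _ _ _) (+-cong refl (x∙yz≈y∙xz _ _ _))

  dilate-sinhLike : ∀ x i → dilate x sinhLike i ≈ dilate x eqSeries i - dilate (- 1#) (dilate x eqSeries) i
  dilate-sinhLike x i =
    trans (distribˡ _ _ _) (+-cong refl (trans (sym (-‿distribʳ-* _ _)) (-‿cong (x∙yz≈y∙xz _ _ _))))

  hermiteSeries-tangent : ∀ T → (∀ m → conv (tanSeries T) coshLike m ≈ sinhLike m) → ∀ x s m →
    conv (dilate x (tanSeries T)) (λ i → hermiteSeries x s i + dilate (- 1#) (hermiteSeries x s) i) m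
      ≈ hermiteSeries x s m - dilate (- 1#) (hermiteSeries x s) m
  hermiteSeries-tangent T tan-def x s m = begin
    conv t (λ i → G i + dilate (- 1#) G i) m
      ≈⟨ conv-congʳ t coshPart m ⟨
    conv t (conv (dilate x coshLike) F) m
      ≈⟨ conv-assoc t (dilate x coshLike) F m ⟩
    conv (conv t (dilate x coshLike)) F m
      ≈⟨ conv-congˡ (λ i → trans (conv-dilate x (tanSeries T) coshLike i) (*-cong refl (tan-def i))) F m ⟩
    conv (dilate x sinhLike) F m
      ≈⟨ sinhPart ⟩
    G m - dilate (- 1#) G m
      ∎
    where
    t : FPS
    t = dilate x (tanSeries T)
    E : FPS
    E = dilate x eqSeries
    F : FPS
    F = spreadEven (hermiteWeight s)
    G : FPS
    G = hermiteSeries x s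

    coshPart : ∀ i → conv (dilate x coshLike) F i ≈ G i + dilate (- 1#) G i
    coshPart i = begin
      conv (dilate x coshLike) F i                   ≈⟨ conv-congˡ (dilate-coshLike x) F i ⟩
      conv (λ j → E j + dilate (- 1#) E j) F i       ≈⟨ conv-distribʳ-+ E _ F i ⟩
      G i + conv (dilate (- 1#) E) F i               ≈⟨ +-cong refl (conv-reflect E F (spreadEven-reflect _) i) ⟩
      G i + dilate (- 1#) G i                        ∎

    sinhPart : conv (dilate x sinhLike) F m ≈ G m - dilate (- 1#) G m
    sinhPart = begin
      conv (dilate x sinhLike) F m                   ≈⟨ conv-congˡ (dilate-sinhLike x) F m ⟩
      conv (λ j → E j - dilate (- 1#) E j) F m       ≈⟨ conv-distribʳ-minus E _ F m ⟩
      G m - conv (dilate (- 1#) E) F m               ≈⟨ +-cong refl (-‿cong (conv-reflect E F (spreadEven-reflect _) m)) ⟩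
      G m - dilate (- 1#) G m                        ∎

  recurrenceTerm : (∀ n → invQ n * qint (suc n) ≈ 1#) → ∀ T x s n k →
    pow (- 1#) k * qbinom (2 N.* n N.+ 1) (2 N.* k N.+ 1) * T k * pow x (2 N.* k N.+ 1)
        * H x s (2 N.* n N.∸ 2 N.* k)
      ≈ qfact (suc (double n)) * (dilate x (tanSeries T) (suc (double k)) * hermiteSeries x s (double (n ∸ k)))
  recurrenceTerm invQ-inv T x s n k
    rewrite 2*n+1≡suc-double n | 2*n+1≡suc-double k | 2*n≡double n | 2*n≡double k = begin
    pow (- 1#) k * (qfact N * qfactInv K * qfactInv (double n ∸ double k)) * T k * pow x K
        * H x s (double n ∸ double k)
      ≡⟨ P.cong (λ j → pow (- 1#) k * (qfact N * qfactInv K * qfactInv j) * T k * pow x K * H x s j)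
                (double-∸ n k) ⟩
    pow (- 1#) k * (qfact N * qfactInv K * qfactInv D) * T k * pow x K * H x s D
      ≈⟨ *-cong refl (H≈qfact*hermiteSeries x s D) ⟩
    pow (- 1#) k * (qfact N * qfactInv K * qfactInv D) * T k * pow x K * (qfact D * G D)
      ≈⟨ *-Solver.solve 8 (λ S F I J t X F′ g →
           ((((S ⊗ ((F ⊗ I) ⊗ J)) ⊗ t) ⊗ X) ⊗ (F′ ⊗ g))
             ⊜ ((F ⊗ ((X ⊗ ((S ⊗ t) ⊗ I)) ⊗ g)) ⊗ (J ⊗ F′)))
           refl (pow (- 1#) k) (qfact N) (qfactInv K) (qfactInv D) (T k) (pow x K) (qfact D) (G D) ⟩
    qfact N * (pow x K * (pow (- 1#) k * T k * qfactInv K) * G D) * (qfactInv D * qfact D)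
      ≈⟨ trans (*-cong refl (qfactInv-inverse invQ-inv D)) (*-identityʳ _) ⟩
    qfact N * (pow x K * (pow (- 1#) k * T k * qfactInv K) * G D)
      ≡⟨ P.cong (λ τ → qfact N * (pow x K * τ * G D)) (tanSeries-suc-double T k) ⟨
    qfact N * (dilate x (tanSeries T) K * G D)
      ∎
    where
    N : ℕ
    N = suc (double n)
    K : ℕ
    K = suc (double k)
    D : ℕ
    D = double (n ∸ k)
    G : FPS
    G = hermiteSeries x s

mainTheorem19 : ∀ {c ℓ : Level} (R : CommutativeRing c ℓ) → let open CommutativeRing R in
    (q : Carrier) (invQ invP : ℕ → Carrier) →
    (∀ n → invQ n * QDefs.qint R q invQ invP (suc n) ≈ 1#) →
    (∀ i → invP i * (1# + QDefs.pow R q invQ invP q (suc i)) ≈ 1#) →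
    (half : Carrier) → half * (1# + 1#) ≈ 1# →
    (T : ℕ → Carrier) →
    (∀ m → QDefs.conv R q invQ invP (QDefs.tanSeries R q invQ invP T) (QDefs.coshLike R q invQ invP) m
             ≈ QDefs.sinhLike R q invQ invP m) →
    (s x : Carrier) (n : ℕ) →
    QDefs.H R q invQ invP x s (2 N.* n N.+ 1)
      ≈ QDefs.sumTo R q invQ invP n (λ k →
          QDefs.pow R q invQ invP (- 1#) k
            * QDefs.qbinom R q invQ invP (2 N.* n N.+ 1) (2 N.* k N.+ 1)
            * T k
            * QDefs.pow R q invQ invP x (2 N.* k N.+ 1)
            * QDefs.H R q invQ invP x s (2 N.* n N.∸ 2 N.* k))
-- The inverses invP of (-q;q)ₖ only enter through the weights aₖ.
mainTheorem19 R q invQ invP invQ-inv _ half half-inv T tan-def s x n = begin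
  H x s (2 N.* n N.+ 1)
    ≡⟨ P.cong (H x s) (2*n+1≡suc-double n) ⟩
  H x s (suc (double n))
    ≈⟨ H≈qfact*hermiteSeries x s (suc (double n)) ⟩
  qfact (suc (double n)) * G (suc (double n))
    ≈⟨ *-cong refl (oddCoefficient-recurrence half half-inv t G t-even (hermiteSeries-tangent T tan-def x s) n) ⟩
  qfact (suc (double n)) * sumTo n (λ k → t (suc (double k)) * G (double (n ∸ k)))
    ≈⟨ *-distribˡ-sumTo n _ _ ⟩
  sumTo n (λ k → qfact (suc (double n)) * (t (suc (double k)) * G (double (n ∸ k))))
    ≈⟨ sumTo-cong′ n (recurrenceTerm invQ-inv T x s n) ⟨
  sumTo n (λ k → pow (- 1#) k * qbinom (2 N.* n N.+ 1) (2 N.* k N.+ 1) * T k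
                   * pow x (2 N.* k N.+ 1) * H x s (2 N.* n N.∸ 2 N.* k))
    ∎
  where
  open CommutativeRing R
  open QDefs R q invQ invP
  open QHermite R q invQ invP
  open import Relation.Binary.Reasoning.Setoid setoid

  t : FPS
  t = dilate x (tanSeries T)
  G : FPS
  G = hermiteSeries x s

  t-even : ∀ k → t (double k) ≈ 0#
  t-even k = trans (*-cong refl (reflexive (tanSeries-double T k))) (zeroʳ _)
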